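{- Let $k\ge 1$ and $n\ge 1$ be integers. Let $A_n=\left(\binom{2i+1}{i-j}\right)_{i,j=0}^{n-1}$ and let $\gamma^{(k)}_n$ be the $n\times n$ matrix (rows and columns indexed by $0,\dots,n-1$) whose $(i,j)$ entry is $1$ if $|i-j|=k$ or $i+j=k-1$, and $0$ otherwise. Then $$A_n\gamma^{(k)}_nA_n^\top=\left(\binom{2i+2j+2}{i+j+1-k}\right)_{i,j=0}^{n-1}.$$
   Context: Binomial coefficients $\binom{a}{b}$ with integer $b<0$ or $b>a$ are $0$. -}

module Defs where

open import Data.Nat using (ℕ; zero; suc; _+_; _*_; _∸_; _≤ᵇ_)
open import Data.Nat.Combinatorics using (_C_)
open import Data.Integer using (ℤ; +_; -[1+_]; _-_)
open import Data.Fin using (Fin; toℕ) renaming (zero to fzero; suc to fsuc)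
open import Data.Bool using (Bool; true; false; if_then_else_; _∨_)
open import Data.Nat using (_≡ᵇ_)

-- Binomial coefficient (a choose b) with integer lower index:
-- 0 when b < 0 (and stdlib's _C_ already gives 0 when b > a).
binomℤ : ℕ → ℤ → ℕ
binomℤ a (+ b)    = a C b
binomℤ a -[1+ _ ] = 0

_⊖ℕ_ : ℕ → ℕ → ℤ
m ⊖ℕ n = (+ m) - (+ n)

Matrix : ℕ → Set
Matrix n = Fin n → Fin n → ℕ

∑ : ∀ {n} → (Fin n → ℕ) → ℕ
∑ {zero}  f = 0
∑ {suc n} f = f fzero + ∑ (λ i → f (fsuc i))

infixl 7 _⊗_
_⊗_ : ∀ {n} → Matrix n → Matrix n → Matrix n
(M ⊗ N) i j = ∑ (λ l → M i l * N l j)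

transpose : ∀ {n} → Matrix n → Matrix n
transpose M i j = M j i

A : (n : ℕ) → Matrix n
A n i j = binomℤ (2 * toℕ i + 1) (toℕ i ⊖ℕ toℕ j)

absDiff : ℕ → ℕ → ℕ
absDiff i j = (i ∸ j) + (j ∸ i)

-- γ^(k)_n : entry 1 if |i-j| = k or i+j = k-1, else 0
-- (k ≥ 1 is assumed in the theorem, so k-1 = k ∸ 1 is the usual natural)
γ : (k n : ℕ) → Matrix n
γ k n i j =
  if (absDiff (toℕ i) (toℕ j) ≡ᵇ k) ∨ ((toℕ i + toℕ j) ≡ᵇ (k ∸ 1)) then 1 else 0

RHS : (k n : ℕ) → Matrix n
RHS k n i j = binomℤ (2 * toℕ i + 2 * toℕ j + 2) ((toℕ i + toℕ j + 1) ⊖ℕ k)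

module Submission where

-- Write k = k'+1, a = 2i+1, b = 2j+1 and R = i+j+1-k.  Column m
-- of γ^(k) has exactly two ones, in rows m+k and partner m (= m-k if m ≥ k,
-- = k-1-m otherwise), so
--   (A γ Aᵀ)_{ij} = Σ_{m ≤ j} A_{jm} (A_{i,m+k} + A_{i,partner m})
-- (A is lower triangular, which cuts the sum at m = j).  By the reflection
-- symmetry of binomial coefficients, for t ≤ j
--   A_{jt} A_{i,partner t} = C(b, j-t) C(a, R-(j-t)),
--   A_{jt} A_{i,t+k}       = C(b, j+1+t) C(a, R-(j+1+t)),
-- so the two halves of the sum are the terms s ≤ j and j < s ≤ b of the
-- Vandermonde convolution Σ_s C(b,s) C(a,R-s) = C(a+b,R), which is the claim.

open import Defs
open import Data.Nat using (ℕ; _≥_)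
open import Data.Fin using (Fin)
open import Relation.Binary.PropositionalEquality using (_≡_)

open import Data.Nat using (zero; suc; _+_; _*_; _∸_; _≤_; _<_; z≤n; s≤s; z<s; s<s; _≡ᵇ_; _≤?_; _≟_)
open import Data.Nat.Properties
open import Data.Nat.Combinatorics using (_C_; nCk≡nC[n∸k]; nCk+nC[k+1]≡[n+1]C[k+1]; k>n⇒nCk≡0)
open import Data.Integer as ℤ using (ℤ; -[1+_]; _⊖_) renaming (+_ to pos)
import Data.Integer.Properties as ℤP
import Data.Integer.Tactic.RingSolver as ℤ-Solver
import Data.Nat.Tactic.RingSolver as ℕ-Solver
open import Data.Fin using (toℕ) renaming (zero to fzero; suc to fsuc)
open import Data.Fin.Properties using (toℕ<n)
open import Data.Bool using (true; false; if_then_else_; _∨_)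
open import Data.Bool.Properties using (T-≡; ¬-not; ∨-zeroʳ)
open import Data.Sum using (_⊎_; inj₁; inj₂)
open import Function using (_∘_)
open import Function.Bundles using (Equivalence)
open import Relation.Binary.PropositionalEquality using (refl; sym; trans; cong; cong₂; _≢_; module ≡-Reasoning)
open import Relation.Nullary using (yes; no)
open import Algebra.Properties.CommutativeSemigroup +-commutativeSemigroup using (interchange)

open ≡-Reasoning

-- Σ< n f = f 0 + f 1 + … + f (n-1).  Sums over ℕ are easier to reindex than
-- the Fin-indexed ∑ of the statement, to which ∑-toℕ relates them.
Σ< : ℕ → (ℕ → ℕ) → ℕ
Σ< zero    f = 0
Σ< (suc n) f = f 0 + Σ< n (f ∘ suc)

∑-cong : ∀ {n} {f g : Fin n → ℕ} → (∀ x → f x ≡ g x) → ∑ f ≡ ∑ g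
∑-cong {zero}  f≗g = refl
∑-cong {suc n} f≗g = cong₂ _+_ (f≗g fzero) (∑-cong (f≗g ∘ fsuc))

∑-toℕ : ∀ n (f : ℕ → ℕ) → ∑ {n} (f ∘ toℕ) ≡ Σ< n f
∑-toℕ zero    f = refl
∑-toℕ (suc n) f = cong (f 0 +_) (∑-toℕ n (f ∘ suc))

Σ<-cong : ∀ n {f g : ℕ → ℕ} → (∀ t → t < n → f t ≡ g t) → Σ< n f ≡ Σ< n g
Σ<-cong zero    f≗g = refl
Σ<-cong (suc n) f≗g = cong₂ _+_ (f≗g 0 z<s) (Σ<-cong n (λ t t<n → f≗g (suc t) (s<s t<n)))

Σ<-+ : ∀ n (f g : ℕ → ℕ) → Σ< n (λ t → f t + g t) ≡ Σ< n f + Σ< n g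
Σ<-+ zero    f g = refl
Σ<-+ (suc n) f g = trans (cong (f 0 + g 0 +_) (Σ<-+ n (f ∘ suc) (g ∘ suc)))
                         (interchange (f 0) (g 0) (Σ< n (f ∘ suc)) (Σ< n (g ∘ suc)))

Σ<-vanish : ∀ n (f : ℕ → ℕ) → (∀ t → t < n → f t ≡ 0) → Σ< n f ≡ 0
Σ<-vanish zero    f f≗0 = refl
Σ<-vanish (suc n) f f≗0 = cong₂ _+_ (f≗0 0 z<s) (Σ<-vanish n (f ∘ suc) (λ t t<n → f≗0 (suc t) (s<s t<n)))

Σ<-split : ∀ p q (f : ℕ → ℕ) → Σ< (p + q) f ≡ Σ< p f + Σ< q (λ t → f (p + t))
Σ<-split zero    q f = refl
Σ<-split (suc p) q f = trans (cong (f 0 +_) (Σ<-split p q (f ∘ suc))) (sym (+-assoc (f 0) _ _))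

Σ<-truncate : ∀ {c n} (f : ℕ → ℕ) → c ≤ n → (∀ t → c ≤ t → f t ≡ 0) → Σ< n f ≡ Σ< c f
Σ<-truncate {c} {n} f c≤n tail≗0 = begin
  Σ< n f                                       ≡⟨ cong (λ N → Σ< N f) (sym (m+[n∸m]≡n c≤n)) ⟩
  Σ< (c + (n ∸ c)) f                           ≡⟨ Σ<-split c (n ∸ c) f ⟩
  Σ< c f + Σ< (n ∸ c) (λ t → f (c + t))        ≡⟨ cong (Σ< c f +_) (Σ<-vanish (n ∸ c) (λ t → f (c + t)) (λ t _ → tail≗0 (c + t) (m≤m+n c t))) ⟩
  Σ< c f + 0                                   ≡⟨ +-identityʳ _ ⟩
  Σ< c f                                       ∎

Σ<-snoc : ∀ n (f : ℕ → ℕ) → Σ< (suc n) f ≡ Σ< n f + f n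
Σ<-snoc zero    f = +-comm (f 0) 0
Σ<-snoc (suc n) f = trans (cong (f 0 +_) (Σ<-snoc n (f ∘ suc))) (sym (+-assoc (f 0) _ _))

Σ<-reverse : ∀ p (f : ℕ → ℕ) → Σ< (suc p) f ≡ Σ< (suc p) (λ t → f (p ∸ t))
Σ<-reverse zero    f = refl
Σ<-reverse (suc p) f = begin
  Σ< (suc (suc p)) f                                ≡⟨ Σ<-snoc (suc p) f ⟩
  Σ< (suc p) f + f (suc p)                          ≡⟨ cong (_+ f (suc p)) (Σ<-reverse p f) ⟩
  Σ< (suc p) (λ t → f (p ∸ t)) + f (suc p)          ≡⟨ +-comm _ (f (suc p)) ⟩
  Σ< (suc (suc p)) (λ t → f (suc p ∸ t))            ∎

Σ<-fold : ∀ p (f : ℕ → ℕ) →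
  Σ< (suc p) (λ t → f (p ∸ t)) + Σ< (suc p) (λ t → f (suc p + t)) ≡ Σ< (suc p + suc p) f
Σ<-fold p f = trans (cong (_+ Σ< (suc p) (λ t → f (suc p + t))) (sym (Σ<-reverse p f)))
                    (sym (Σ<-split (suc p) (suc p) f))

≡ᵇ-true : ∀ {m n} → m ≡ n → (m ≡ᵇ n) ≡ true
≡ᵇ-true {m} {n} m≡n = Equivalence.to T-≡ (≡⇒≡ᵇ m n m≡n)

≡ᵇ-false : ∀ {m n} → m ≢ n → (m ≡ᵇ n) ≡ false
≡ᵇ-false {m} {n} m≢n = ¬-not (m≢n ∘ ≡ᵇ⇒≡ m n ∘ Equivalence.from T-≡)

δ : ℕ → ℕ → ℕ
δ l c = if l ≡ᵇ c then 1 else 0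

δ-≡ : ∀ {l c} → l ≡ c → δ l c ≡ 1
δ-≡ l≡c rewrite ≡ᵇ-true l≡c = refl

δ-≢ : ∀ {l c} → l ≢ c → δ l c ≡ 0
δ-≢ l≢c rewrite ≡ᵇ-false l≢c = refl

Σ<-sift : ∀ n (f : ℕ → ℕ) c → (n ≤ c → f c ≡ 0) → Σ< n (λ l → f l * δ l c) ≡ f c
Σ<-sift zero    f c       out = sym (out z≤n)
Σ<-sift (suc n) f zero    out = begin
  f 0 * 1 + Σ< n (λ t → f (suc t) * 0)   ≡⟨ cong₂ _+_ (*-identityʳ (f 0)) (Σ<-vanish n _ (λ t _ → *-zeroʳ (f (suc t)))) ⟩
  f 0 + 0                                ≡⟨ +-identityʳ (f 0) ⟩
  f 0                                    ∎
Σ<-sift (suc n) f (suc c) out =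
  cong₂ _+_ (*-zeroʳ (f 0)) (Σ<-sift n (f ∘ suc) c (out ∘ s≤s))

binomℤ-neg : ∀ a {m n} → m < n → binomℤ a (m ⊖ n) ≡ 0
binomℤ-neg a {zero}  {suc n} _         = refl
binomℤ-neg a {suc m} {suc n} (s<s m<n) =
  trans (cong (binomℤ a) (ℤP.[1+m]⊖[1+n]≡m⊖n m n)) (binomℤ-neg a m<n)

+-∸ : ∀ {m n} → n ≤ m → pos (m ∸ n) ≡ pos m ℤ.- pos n
+-∸ {m} {n} n≤m = sym (trans (ℤP.[+m]-[+n]≡m⊖n m n) (ℤP.⊖-≥ n≤m))

pascal : ∀ a X → binomℤ (suc a) X ≡ binomℤ a X + binomℤ a (X ℤ.- pos 1)
pascal a (pos zero)    = refl
pascal a (pos (suc t)) = trans (sym (nCk+nC[k+1]≡[n+1]C[k+1] a t)) (+-comm (a C t) _)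
pascal a -[1+ t ]     = refl

reflection : ∀ a X → binomℤ a X ≡ binomℤ a (pos a ℤ.- X)
reflection a (pos x) with x ≤? a
... | yes x≤a = trans (nCk≡nC[n∸k] x≤a) (cong (binomℤ a) (+-∸ x≤a))
... | no  x≰a = trans (k>n⇒nCk≡0 (≰⇒> x≰a))
  (sym (trans (cong (binomℤ a) (ℤP.[+m]-[+n]≡m⊖n a x)) (binomℤ-neg a (≰⇒> x≰a))))
reflection a -[1+ x ] = sym (k>n⇒nCk≡0 (m<m+n a {suc x} z<s))

binomℤ-0 : ∀ r s → binomℤ 0 (r ⊖ s) ≡ δ s r
binomℤ-0 zero    zero    = refl
binomℤ-0 zero    (suc s) = refl
binomℤ-0 (suc r) zero    = refl
binomℤ-0 (suc r) (suc s) = trans (cong (binomℤ 0) (ℤP.[1+m]⊖[1+n]≡m⊖n r s)) (binomℤ-0 r s)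

binomℤ-0-neg : ∀ r s → binomℤ 0 (-[1+ r ] ℤ.- pos s) ≡ 0
binomℤ-0-neg r zero    = refl
binomℤ-0-neg r (suc s) = refl

vandermonde : ∀ a b R → Σ< (suc b) (λ s → (b C s) * binomℤ a (R ℤ.- pos s)) ≡ binomℤ (a + b) R
vandermonde zero b (pos r) = trans
  (Σ<-cong (suc b) (λ s _ → cong ((b C s) *_)
     (trans (cong (binomℤ 0) (ℤP.[+m]-[+n]≡m⊖n r s)) (binomℤ-0 r s))))
  (Σ<-sift (suc b) (b C_) r k>n⇒nCk≡0)
vandermonde zero b -[1+ r ] =
  Σ<-vanish (suc b) _ (λ s _ → trans (cong ((b C s) *_) (binomℤ-0-neg r s)) (*-zeroʳ (b C s)))
vandermonde (suc a) b R = begin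
  Σ< (suc b) (λ s → (b C s) * binomℤ (suc a) (R ℤ.- pos s))  ≡⟨ Σ<-cong (suc b) (λ s _ → pascal-term s) ⟩
  Σ< (suc b) (λ s → term R s + term (R ℤ.- pos 1) s)         ≡⟨ Σ<-+ (suc b) (term R) (term (R ℤ.- pos 1)) ⟩
  Σ< (suc b) (term R) + Σ< (suc b) (term (R ℤ.- pos 1))      ≡⟨ cong₂ _+_ (vandermonde a b R) (vandermonde a b (R ℤ.- pos 1)) ⟩
  binomℤ (a + b) R + binomℤ (a + b) (R ℤ.- pos 1)            ≡⟨ pascal (a + b) R ⟨
  binomℤ (suc a + b) R                                     ∎
  where
  term : ℤ → ℕ → ℕ
  term X s = (b C s) * binomℤ a (X ℤ.- pos s)

  shift-swap : ∀ (X Y : ℤ) → (X ℤ.- Y) ℤ.- pos 1 ≡ (X ℤ.- pos 1) ℤ.- Y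
  shift-swap = ℤ-Solver.solve-∀

  pascal-term : ∀ s → (b C s) * binomℤ (suc a) (R ℤ.- pos s) ≡ term R s + term (R ℤ.- pos 1) s
  pascal-term s = trans (cong ((b C s) *_)
    (trans (pascal a (R ℤ.- pos s)) (cong (binomℤ a (R ℤ.- pos s) +_) (cong (binomℤ a) (shift-swap R (pos s))))))
    (*-distribˡ-+ (b C s) _ _)

Aκ : ℕ → ℕ → ℕ
Aκ i c = binomℤ (2 * i + 1) (i ⊖ℕ c)

Aκ-upper : ∀ {i c} → i < c → Aκ i c ≡ 0
Aκ-upper {i} {c} i<c = trans (cong (binomℤ (2 * i + 1)) (ℤP.[+m]-[+n]≡m⊖n i c)) (binomℤ-neg _ i<c)

Aκ-lower : ∀ {i c} → c ≤ i → Aκ i c ≡ (2 * i + 1) C (i ∸ c)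
Aκ-lower {i} c≤i = cong (binomℤ (2 * i + 1)) (sym (+-∸ c≤i))

+-odd : ∀ i → pos (2 * i + 1) ≡ pos i ℤ.+ pos i ℤ.+ pos 1
+-odd i = cong (λ x → pos (i + x + 1)) (+-identityʳ i)

Γ : ℕ → ℕ → ℕ → ℕ
Γ k l m = if (absDiff l m ≡ᵇ k) ∨ ((l + m) ≡ᵇ (k ∸ 1)) then 1 else 0

absDiff-≤ : ∀ {l m} → l ≤ m → absDiff l m ≡ m ∸ l
absDiff-≤ {l} {m} l≤m = cong (_+ (m ∸ l)) (m≤n⇒m∸n≡0 l≤m)

absDiff-≥ : ∀ {l m} → m ≤ l → absDiff l m ≡ l ∸ m
absDiff-≥ {l} {m} m≤l = trans (cong ((l ∸ m) +_) (m≤n⇒m∸n≡0 m≤l)) (+-identityʳ (l ∸ m))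

absDiff-inv : ∀ l m k → absDiff l m ≡ k → l ≡ m + k ⊎ m ≡ l + k
absDiff-inv l m k d≡k with ≤-total l m
... | inj₁ l≤m = inj₂ (trans (sym (m+[n∸m]≡n l≤m)) (cong (l +_) (trans (sym (absDiff-≤ l≤m)) d≡k)))
... | inj₂ m≤l = inj₁ (trans (sym (m+[n∸m]≡n m≤l)) (cong (m +_) (trans (sym (absDiff-≥ m≤l)) d≡k)))

-- Besides row m + k, column m of γ^(k'+1) has its other one in row
-- partner k' m, which is m - (k'+1) if m > k' and k' - m otherwise.
partner : ℕ → ℕ → ℕ
partner k' m = (m ∸ suc k') + (k' ∸ m)

partner-≥ : ∀ {k' m} → suc k' ≤ m → partner k' m ≡ m ∸ suc k'
partner-≥ {k'} {m} k<m = trans (cong (m ∸ suc k' +_) (m≤n⇒m∸n≡0 (<⇒≤ k<m))) (+-identityʳ _)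

partner-≤ : ∀ {k' m} → m ≤ k' → partner k' m ≡ k' ∸ m
partner-≤ {k'} {m} m≤k' = cong (_+ (k' ∸ m)) (m≤n⇒m∸n≡0 (m≤n⇒m≤1+n m≤k'))

partner<shift : ∀ k' m → partner k' m < m + suc k'
partner<shift k' m with suc k' ≤? m
... | yes k<m = ≤-<-trans (≤-reflexive (partner-≥ k<m)) (≤-<-trans (m∸n≤m m (suc k')) (m<m+n m z<s))
... | no  k≮m = ≤-<-trans (≤-reflexive (partner-≤ (≤-pred (≰⇒> k≮m))))
                  (≤-<-trans (m∸n≤m k' m) (≤-trans (n<1+n k') (m≤n+m (suc k') m)))

Γ-by-distance : ∀ {k l m} → absDiff l m ≡ k → Γ k l m ≡ 1
Γ-by-distance d≡k rewrite ≡ᵇ-true d≡k = refl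

Γ-by-sum : ∀ {k l m} → l + m ≡ k ∸ 1 → Γ k l m ≡ 1
Γ-by-sum {k} {l} {m} l+m≡k-1 rewrite ≡ᵇ-true l+m≡k-1 | ∨-zeroʳ (absDiff l m ≡ᵇ k) = refl

Γ-by-neither : ∀ {k l m} → absDiff l m ≢ k → l + m ≢ k ∸ 1 → Γ k l m ≡ 0
Γ-by-neither d≢k l+m≢k-1 rewrite ≡ᵇ-false d≢k | ≡ᵇ-false l+m≢k-1 = refl

Γ-at-shift : ∀ {k l m} → l ≡ m + k → Γ k l m ≡ 1
Γ-at-shift {k} {l} {m} l≡m+k = Γ-by-distance {k} {l} {m} (begin
  absDiff l m        ≡⟨ cong (λ x → absDiff x m) l≡m+k ⟩
  absDiff (m + k) m  ≡⟨ absDiff-≥ (m≤m+n m k) ⟩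
  m + k ∸ m          ≡⟨ m+n∸m≡n m k ⟩
  k                  ∎)

Γ-at-partner : ∀ {k' l m} → l ≡ partner k' m → Γ (suc k') l m ≡ 1
Γ-at-partner {k'} {l} {m} l≡p with suc k' ≤? m
... | yes k≤m = Γ-by-distance {suc k'} {l} {m} (trans (absDiff-≤ l≤m) (trans (cong (m ∸_) l≡m∸k) (m∸[m∸n]≡n k≤m)))
  where
  l≡m∸k : l ≡ m ∸ suc k'
  l≡m∸k = trans l≡p (partner-≥ k≤m)
  l≤m : l ≤ m
  l≤m = ≤-trans (≤-reflexive l≡m∸k) (m∸n≤m m (suc k'))
... | no  k≰m = Γ-by-sum {suc k'} {l} {m} (trans (cong (_+ m) (trans l≡p (partner-≤ m≤k'))) (m∸n+n≡m m≤k'))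
  where
  m≤k' : m ≤ k'
  m≤k' = ≤-pred (≰⇒> k≰m)

Γ-elsewhere : ∀ {k' l m} → l ≢ m + suc k' → l ≢ partner k' m → Γ (suc k') l m ≡ 0
Γ-elsewhere {k'} {l} {m} not-shift not-partner = Γ-by-neither {suc k'} {l} {m} not-distance not-reflected
  where
  not-distance : absDiff l m ≢ suc k'
  not-distance d≡k with absDiff-inv l m (suc k') d≡k
  ... | inj₁ l≡m+k = not-shift l≡m+k
  ... | inj₂ m≡l+k = not-partner (sym (begin
    partner k' m       ≡⟨ partner-≥ (≤-trans (m≤n+m (suc k') l) (≤-reflexive (sym m≡l+k))) ⟩
    m ∸ suc k'         ≡⟨ cong (_∸ suc k') m≡l+k ⟩
    l + suc k' ∸ suc k' ≡⟨ m+n∸n≡m l (suc k') ⟩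
    l                  ∎))
  not-reflected : l + m ≢ k'
  not-reflected l+m≡k' = not-partner (sym (begin
    partner k' m       ≡⟨ partner-≤ (≤-trans (m≤n+m m l) (≤-reflexive l+m≡k')) ⟩
    k' ∸ m             ≡⟨ cong (_∸ m) (sym l+m≡k') ⟩
    l + m ∸ m          ≡⟨ m+n∸n≡m l m ⟩
    l                  ∎))

γ-column : ∀ k' l m → Γ (suc k') l m ≡ δ l (m + suc k') + δ l (partner k' m)
γ-column k' l m with l ≟ m + suc k' | l ≟ partner k' m
... | yes l≡s | _       = trans (Γ-at-shift l≡s)
  (sym (cong₂ _+_ (δ-≡ l≡s) (δ-≢ (λ l≡p → <-irrefl (trans (sym l≡p) l≡s) (partner<shift k' m)))))
... | no  l≢s | yes l≡p = trans (Γ-at-partner l≡p) (sym (cong₂ _+_ (δ-≢ l≢s) (δ-≡ l≡p)))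
... | no  l≢s | no  l≢p = trans (Γ-elsewhere l≢s l≢p) (sym (cong₂ _+_ (δ-≢ l≢s) (δ-≢ l≢p)))

onFin : (n : ℕ) → (ℕ → ℕ → ℕ) → Matrix n
onFin n K x y = K (toℕ x) (toℕ y)

sandwich-entry : ∀ n (M G P : ℕ → ℕ → ℕ) (i j : Fin n) →
  (onFin n M ⊗ onFin n G ⊗ transpose (onFin n P)) i j
    ≡ Σ< n (λ m → Σ< n (λ l → M (toℕ i) l * G l m) * P (toℕ j) m)
sandwich-entry n M G P i j = trans
  (∑-cong {n} (λ m → cong (_* P (toℕ j) (toℕ m)) (∑-toℕ n (λ l → M (toℕ i) l * G l (toℕ m)))))
  (∑-toℕ n (λ m → Σ< n (λ l → M (toℕ i) l * G l m) * P (toℕ j) m))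

module Entry (k' i j : ℕ) where
  k a b : ℕ
  k = suc k'
  a = 2 * i + 1
  b = 2 * j + 1

  R : ℤ
  R = (i + j + 1) ⊖ℕ k

  term : ℕ → ℕ
  term s = (b C s) * binomℤ a (R ℤ.- pos s)

  Aγ : ℕ → ℕ
  Aγ m = Aκ i (m + k) + Aκ i (partner k' m)

  Aγ-entry : ∀ n → i < n → ∀ m → Σ< n (λ l → Aκ i l * Γ k l m) ≡ Aγ m
  Aγ-entry n i<n m = begin
    Σ< n (λ l → Aκ i l * Γ k l m)
      ≡⟨ Σ<-cong n (λ l _ → trans (cong (Aκ i l *_) (γ-column k' l m)) (*-distribˡ-+ (Aκ i l) _ _)) ⟩
    Σ< n (λ l → Aκ i l * δ l (m + k) + Aκ i l * δ l (partner k' m))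
      ≡⟨ Σ<-+ n _ _ ⟩
    Σ< n (λ l → Aκ i l * δ l (m + k)) + Σ< n (λ l → Aκ i l * δ l (partner k' m))
      ≡⟨ cong₂ _+_ (Σ<-sift n (Aκ i) _ outside) (Σ<-sift n (Aκ i) _ outside) ⟩
    Aκ i (m + k) + Aκ i (partner k' m) ∎
    where
    outside : ∀ {c} → n ≤ c → Aκ i c ≡ 0
    outside n≤c = Aκ-upper (<-≤-trans i<n n≤c)

  -- For t ≤ j, the pairs (row j, column t) of A with the two selected entries
  -- are the Vandermonde terms s = j - t and s = j+1+t.
  reflected-index-≥ : ∀ (I J T K : ℤ) →
    (I ℤ.+ I ℤ.+ pos 1) ℤ.- (((I ℤ.+ J ℤ.+ pos 1) ℤ.- K) ℤ.- (J ℤ.- T)) ≡ I ℤ.- (T ℤ.- K)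
  reflected-index-≥ = ℤ-Solver.solve-∀

  reflected-index-< : ∀ (I J T K' : ℤ) →
    ((I ℤ.+ J ℤ.+ pos 1) ℤ.- (pos 1 ℤ.+ K')) ℤ.- (J ℤ.- T) ≡ I ℤ.- (K' ℤ.- T)
  reflected-index-< = ℤ-Solver.solve-∀

  shifted-index : ∀ (I J T K : ℤ) → ((I ℤ.+ J ℤ.+ pos 1) ℤ.- K) ℤ.- ((pos 1 ℤ.+ J) ℤ.+ T) ≡ I ℤ.- (T ℤ.+ K)
  shifted-index = ℤ-Solver.solve-∀

  shifted-column : ∀ (J T : ℤ) → (J ℤ.+ J ℤ.+ pos 1) ℤ.- ((pos 1 ℤ.+ J) ℤ.+ T) ≡ J ℤ.- T
  shifted-column = ℤ-Solver.solve-∀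

  partner-factor : ∀ t → binomℤ a (R ℤ.- (pos j ℤ.- pos t)) ≡ Aκ i (partner k' t)
  partner-factor t with k ≤? t
  ... | yes k≤t = begin
    binomℤ a (R ℤ.- (pos j ℤ.- pos t))                    ≡⟨ reflection a (R ℤ.- (pos j ℤ.- pos t)) ⟩
    binomℤ a (pos a ℤ.- (R ℤ.- (pos j ℤ.- pos t)))          ≡⟨ cong (λ A → binomℤ a (A ℤ.- (R ℤ.- (pos j ℤ.- pos t)))) (+-odd i) ⟩
    binomℤ a (pos i ℤ.+ pos i ℤ.+ pos 1 ℤ.- (R ℤ.- (pos j ℤ.- pos t)))
                                                      ≡⟨ cong (binomℤ a) (reflected-index-≥ (pos i) (pos j) (pos t) (pos k)) ⟩
    binomℤ a (pos i ℤ.- (pos t ℤ.- pos k))                  ≡⟨ cong (λ X → binomℤ a (pos i ℤ.- X)) (+-∸ k≤t) ⟨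
    Aκ i (t ∸ k)                                      ≡⟨ cong (Aκ i) (partner-≥ k≤t) ⟨
    Aκ i (partner k' t)                               ∎
  ... | no  k≰t = begin
    binomℤ a (R ℤ.- (pos j ℤ.- pos t))                    ≡⟨ cong (binomℤ a) (reflected-index-< (pos i) (pos j) (pos t) (pos k')) ⟩
    binomℤ a (pos i ℤ.- (pos k' ℤ.- pos t))                 ≡⟨ cong (λ X → binomℤ a (pos i ℤ.- X)) (+-∸ t≤k') ⟨
    Aκ i (k' ∸ t)                                     ≡⟨ cong (Aκ i) (partner-≤ t≤k') ⟨
    Aκ i (partner k' t)                               ∎
    where
    t≤k' : t ≤ k'
    t≤k' = ≤-pred (≰⇒> k≰t)

  term-reflected : ∀ {t} → t ≤ j → term (j ∸ t) ≡ Aκ j t * Aκ i (partner k' t)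
  term-reflected {t} t≤j = cong₂ _*_ (sym (Aκ-lower t≤j))
    (trans (cong (λ X → binomℤ a (R ℤ.- X)) (+-∸ t≤j)) (partner-factor t))

  term-shifted : ∀ {t} → t ≤ j → term (suc j + t) ≡ Aκ j t * Aκ i (t + k)
  term-shifted {t} t≤j = cong₂ _*_ column-factor
    (cong (binomℤ a) (shifted-index (pos i) (pos j) (pos t) (pos k)))
    where
    column-factor : b C (suc j + t) ≡ Aκ j t
    column-factor = begin
      binomℤ b (pos (suc j + t))                         ≡⟨ reflection b (pos (suc j + t)) ⟩
      binomℤ b (pos b ℤ.- pos (suc j + t))                 ≡⟨ cong (λ B → binomℤ b (B ℤ.- pos (suc j + t))) (+-odd j) ⟩
      binomℤ b (pos j ℤ.+ pos j ℤ.+ pos 1 ℤ.- pos (suc j + t)) ≡⟨ cong (binomℤ b) (shifted-column (pos j) (pos t)) ⟩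
      Aκ j t                                           ∎

  paired-terms : ∀ {t} → t ≤ j → Aγ t * Aκ j t ≡ term (j ∸ t) + term (suc j + t)
  paired-terms {t} t≤j = begin
    (Aκ i (t + k) + Aκ i (partner k' t)) * Aκ j t         ≡⟨ *-distribʳ-+ (Aκ j t) (Aκ i (t + k)) _ ⟩
    Aκ i (t + k) * Aκ j t + Aκ i (partner k' t) * Aκ j t  ≡⟨ +-comm (Aκ i (t + k) * Aκ j t) _ ⟩
    Aκ i (partner k' t) * Aκ j t + Aκ i (t + k) * Aκ j t  ≡⟨ cong₂ _+_ (*-comm _ (Aκ j t)) (*-comm _ (Aκ j t)) ⟩
    Aκ j t * Aκ i (partner k' t) + Aκ j t * Aκ i (t + k)  ≡⟨ cong₂ _+_ (term-reflected t≤j) (term-shifted t≤j) ⟨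
    term (j ∸ t) + term (suc j + t)                       ∎

  entry : ∀ n → i < n → j < n →
    Σ< n (λ m → Σ< n (λ l → Aκ i l * Γ k l m) * Aκ j m) ≡ binomℤ (2 * i + 2 * j + 2) R
  entry n i<n j<n = begin
    Σ< n (λ m → Σ< n (λ l → Aκ i l * Γ k l m) * Aκ j m)
      ≡⟨ Σ<-cong n (λ m _ → cong (_* Aκ j m) (Aγ-entry n i<n m)) ⟩
    Σ< n (λ m → Aγ m * Aκ j m)
      ≡⟨ Σ<-truncate (λ m → Aγ m * Aκ j m) j<n (λ m j<m → trans (cong (Aγ m *_) (Aκ-upper j<m)) (*-zeroʳ (Aγ m))) ⟩
    Σ< (suc j) (λ m → Aγ m * Aκ j m)
      ≡⟨ Σ<-cong (suc j) (λ t t<1+j → paired-terms (≤-pred t<1+j)) ⟩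
    Σ< (suc j) (λ t → term (j ∸ t) + term (suc j + t))
      ≡⟨ Σ<-+ (suc j) (λ t → term (j ∸ t)) (λ t → term (suc j + t)) ⟩
    Σ< (suc j) (λ t → term (j ∸ t)) + Σ< (suc j) (λ t → term (suc j + t))
      ≡⟨ Σ<-fold j term ⟩
    Σ< (suc j + suc j) term
      ≡⟨ cong (λ N → Σ< N term) (double-length j) ⟩
    Σ< (suc b) term
      ≡⟨ vandermonde a b R ⟩
    binomℤ (a + b) R
      ≡⟨ cong (λ N → binomℤ N R) (total-degree i j) ⟩
    binomℤ (2 * i + 2 * j + 2) R ∎
    where
    double-length : ∀ x → suc x + suc x ≡ suc (2 * x + 1)
    double-length = ℕ-Solver.solve-∀
    total-degree : ∀ x y → (2 * x + 1) + (2 * y + 1) ≡ 2 * x + 2 * y + 2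
    total-degree = ℕ-Solver.solve-∀

theorem4p2 : (k n : ℕ) → k ≥ 1 → n ≥ 1 →
    (i j : Fin n) → (A n ⊗ γ k n ⊗ transpose (A n)) i j ≡ RHS k n i j
theorem4p2 (suc k') n _ _ i j = begin
  (A n ⊗ γ (suc k') n ⊗ transpose (A n)) i j
    ≡⟨ sandwich-entry n Aκ (Γ (suc k')) Aκ i j ⟩
  Σ< n (λ m → Σ< n (λ l → Aκ (toℕ i) l * Γ (suc k') l m) * Aκ (toℕ j) m)
    ≡⟨ Entry.entry k' (toℕ i) (toℕ j) n (toℕ<n i) (toℕ<n j) ⟩
  RHS (suc k') n i j ∎
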